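{- Let $G$ be a minimal nonperfectly divisible fork-free graph, $v\in V(G)$, and $C=v_1v_2\cdots v_nv_1$ an odd hole contained in $G[M(v)]$. For every $i\in\{1,\dots,n\}$ and every $z\in Z\cap N(U_i)$, either $N_C(z)=\{v_i,v_{i+1}\}$, or $N_C(z)=\{v_i,v_{i+1}\}\cup\{v_j,v_{j+1}\}$ for some $j\neq i$.
   Context: All graphs are finite and simple. A fork is the graph obtained from $K_{1,3}$ by subdividing one edge once; fork-free means no induced fork. A graph is perfect if $\chi(H)=\omega(H)$ for every induced subgraph $H$. A perfect division of $G$ is a partition $(A,B)$ of $V(G)$ with $G[A]$ perfect and $\omega(G[B])<\omega(G)$; $G$ is perfectly divisible if every induced subgraph has a perfect division; $G$ is minimal nonperfectly divisible if it is not perfectly divisible but all its proper induced subgraphs are. A hole is an induced cycle of length at least 4; an odd hole is a hole of odd length. For $x\in V(G)$, $M(x)=V(G)\setminus(N(x)\cup\{x\})$; for $X\subseteq V(G)$, $N(X)=\bigcup_{x\in X}N(x)\setminus X$; for a subgraph $C$, $N_C(x)=N(x)\cap V(C)$, $N(C)=N(V(C))$, $M(C)=V(G)\setminus(V(C)\cup N(C))$. Indices modulo $n$. Define $U=\{u\in N(M(C)) : N_C(u)=\{v_i,v_{i+1}\}$ for some $i\}$, $U_i=\{u\in U: N_C(u)=\{v_i,v_{i+1}\}\}$ (so $N_C(u_i)=\{v_i,v_{i+1}\}$ for $u_i\in U_i$), and $Z=\{z\in N(C)\setminus N(M(C)) : z$ not adjacent to all of $V(C)\}$. -}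

module Defs where

open import Data.Nat using (ℕ; zero; suc; _≤_; _<_; _*_)
open import Data.Nat.DivMod using (_%_; m%n<n)
open import Data.Fin using (Fin; toℕ; fromℕ<)
open import Data.Fin.Subset using (Subset; _∈_; _∉_; _⊆_; ⊤; Nonempty)
open import Data.Product using (Σ; ∃; _×_; _,_)
open import Data.Sum using (_⊎_)
open import Data.Empty using (⊥)
open import Relation.Nullary using (¬_; Dec)
open import Relation.Binary.PropositionalEquality using (_≡_; _≢_)

infix 2 _⟺_
_⟺_ : Set → Set → Set
A ⟺ B = (A → B) × (B → A)

record Graph : Set₁ where
  field
    size     : ℕ
    _~_      : Fin size → Fin size → Set
    ~-dec    : ∀ x y → Dec (x ~ y)
    ~-sym    : ∀ {x y} → x ~ y → y ~ x
    ~-irrefl : ∀ {x} → ¬ (x ~ x)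

next : ∀ {n} → Fin n → Fin n
next {suc m} i = fromℕ< (m%n<n (suc (toℕ i)) (suc m))

module _ (G : Graph) where
  open Graph G

  V : Set
  V = Fin size

  record Clique (S : Subset size) (k : ℕ) : Set where
    field
      vert : Fin k → V
      inj  : ∀ i j → vert i ≡ vert j → i ≡ j
      inS  : ∀ i → vert i ∈ S
      adj  : ∀ i j → i ≢ j → vert i ~ vert j

  Colouring : Subset size → ℕ → Set
  Colouring S k = Σ ((x : V) → x ∈ S → Fin k) λ col →
    ∀ x y (hx : x ∈ S) (hy : y ∈ S) → x ~ y → col x hx ≢ col y hy

  CliqueNumber : Subset size → ℕ → Set
  CliqueNumber S k = Clique S k × (∀ m → Clique S m → m ≤ k)

  ChromaticNumber : Subset size → ℕ → Set
  ChromaticNumber S k = Colouring S k × (∀ m → Colouring S m → k ≤ m)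

  Perfect : Subset size → Set
  Perfect S = ∀ T → T ⊆ S → ∀ k → CliqueNumber T k → ChromaticNumber T k

  PerfectDivision : Subset size → Set
  PerfectDivision T = Σ (Subset size) λ A → Σ (Subset size) λ B →
    (A ⊆ T) × (B ⊆ T) × (∀ x → x ∈ T → x ∈ A ⊎ x ∈ B) × (∀ x → x ∈ A → x ∈ B → ⊥) ×
    Perfect A × (Σ ℕ λ w → CliqueNumber T w × (∀ m → Clique B m → m < w))

  PerfectlyDivisible : Subset size → Set
  PerfectlyDivisible S = ∀ T → T ⊆ S → Nonempty T → PerfectDivision T

  MinimalNonPerfectlyDivisible : Set
  MinimalNonPerfectlyDivisible =
    ¬ PerfectlyDivisible ⊤ × (∀ S → (∃ λ x → x ∉ S) → PerfectlyDivisible S)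

  -- forks: K_{1,3} with centre a, leaves b c d, edge a-d subdivided by e
  record InducedFork (a b c d e : V) : Set where
    field
      ab : a ~ b
      ac : a ~ c
      ad : a ~ d
      de : d ~ e
      nbc : ¬ b ~ c
      nbd : ¬ b ~ d
      nbe : ¬ b ~ e
      ncd : ¬ c ~ d
      nce : ¬ c ~ e
      nae : ¬ a ~ e
      b≢c : b ≢ c

  ForkFree : Set
  ForkFree = ∀ a b c d e → ¬ InducedFork a b c d e

  InM : V → V → Set
  InM x y = y ≢ x × ¬ (x ~ y)

  InN : (V → Set) → V → Set
  InN X y = ¬ X y × ∃ λ x → X x × x ~ y

  record OddHole (n : ℕ) (c : Fin n → V) : Set where
    field
      length≥4 : 4 ≤ n
      odd      : ∃ λ k → n ≡ suc (2 * k)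
      inj      : ∀ i j → c i ≡ c j → i ≡ j
      induced  : ∀ i j → (c i ~ c j) ⟺ (j ≡ next i ⊎ i ≡ next j)

  module _ {n : ℕ} (c : Fin n → V) where
    InC : V → Set
    InC x = ∃ λ k → c k ≡ x

    InNC : V → V → Set
    InNC x y = InC y × x ~ y

    InNofC : V → Set
    InNofC = InN InC

    InMofC : V → Set
    InMofC x = ¬ InC x × ¬ InNofC x

    InNMofC : V → Set
    InNMofC = InN InMofC

    NCpair : V → Fin n → Set
    NCpair x i = ∀ y → InNC x y ⟺ (y ≡ c i ⊎ y ≡ c (next i))

    InU : V → Set
    InU u = InNMofC u × ∃ λ i → NCpair u i

    InUi : Fin n → V → Set
    InUi i u = InU u × NCpair u i

    InZ : V → Set
    InZ z = InNofC z × ¬ InNMofC z × ¬ (∀ k → z ~ c k)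

-- Take u ∈ Uᵢ adjacent to z and a neighbour w ∈ M(C) of u, so z–u–w is an induced path,
-- w has no neighbour on C and u sees exactly vᵢ, vᵢ₊₁.  Fork-freeness gives three facts.
-- (1) Two neighbours of z on C away from vᵢvᵢ₊₁ are adjacent, or z with them and u–w is a fork;
-- as C is triangle-free they span at most one edge of C.  (2) z sees vᵢ₊₁: otherwise there is
-- a fork centred at u or at vᵢ₊₂; reversing C, z also sees vᵢ.  (3) A neighbour v_a of z away
-- from vᵢvᵢ₊₁ whose two C-neighbours are also away from it sees one of them, or v_a with
-- v_{a-1}, v_{a+1} and z–u is a fork.  What remains is a case analysis on the cycle alone.
module Submission where

open import Defs
open import Data.Nat using (ℕ; zero; suc; _+_; _*_; _≤_; z≤n; s≤s; NonZero)
open import Data.Nat.Properties using (+-comm; +-suc; +-identityʳ; +-cancelˡ-≡; ≤-trans; *-monoʳ-≤)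
open import Data.Nat.DivMod using (_%_; _/_; m%n<n; m<n⇒m%n≡m; m≡m%n+[m/n]*n; %-distribˡ-+; m%n%n≡m%n; %-remove-+ʳ)
open import Data.Nat.Divisibility using (_∣_; divides; ∣-refl; >⇒∤)
open import Data.Nat.GeneralisedArithmetic using (fold; fold-+)
open import Data.Fin using (Fin; toℕ; _≟_)
open import Data.Fin.Properties using (toℕ-fromℕ<; toℕ-injective; toℕ<n; any?)
open import Data.List using (List; []; _∷_; map)
open import Data.Product using (∃; _×_; _,_; proj₁; proj₂; map₂)
open import Data.Sum using (_⊎_; inj₁; inj₂; [_,_])
open import Data.Empty using (⊥-elim)
open import Function using (_∘_)
open import Relation.Nullary using (¬_; yes; no)
open import Relation.Nullary.Decidable using (¬?; _×-dec_)
open import Relation.Unary using (Decidable)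
open import Relation.Binary.PropositionalEquality hiding ([_])

fold-succ : ∀ {A : Set} (s : A → A) x k → fold (s x) s k ≡ s (fold x s k)
fold-succ s x k = trans (sym (fold-+ x s k)) (cong (fold x s) (+-comm k 1))

-- The index cycle of a hole; the length n ≥ 5 enters only as the absence of orbits of length ≤ 4.
record Rotation (A : Set) : Set where
  field
    succ pred : A → A
    succ-pred : ∀ a → succ (pred a) ≡ a
    pred-succ : ∀ a → pred (succ a) ≡ a
    short-orbit-free : ∀ k a .{{_ : NonZero k}} → k ≤ 4 → fold a succ k ≢ a

  Adjacent : A → A → Set
  Adjacent a b = b ≡ succ a ⊎ a ≡ succ b

  OffEdge : A → A → Set
  OffEdge a k = k ≢ a × k ≢ succ a

module RotationProperties {A : Set} (R : Rotation A) where
  open Rotation R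

  succ-injective : ∀ {a b} → succ a ≡ succ b → a ≡ b
  succ-injective {a} {b} e = trans (sym (pred-succ a)) (trans (cong pred e) (pred-succ b))

  succ⇒pred : ∀ {a b} → a ≡ succ b → b ≡ pred a
  succ⇒pred {a} {b} e = trans (sym (pred-succ b)) (cong pred (sym e))

  pred⇒succ : ∀ {a b} → b ≡ pred a → a ≡ succ b
  pred⇒succ {a} {b} e = trans (sym (succ-pred a)) (cong succ (sym e))

  succ≢ : ∀ a → succ a ≢ a
  succ≢ a = short-orbit-free 1 a (s≤s z≤n)

  succ²≢ : ∀ a → succ (succ a) ≢ a
  succ²≢ a = short-orbit-free 2 a (s≤s (s≤s z≤n))

  succ³≢ : ∀ a → succ (succ (succ a)) ≢ a
  succ³≢ a = short-orbit-free 3 a (s≤s (s≤s (s≤s z≤n)))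

  succ⁴≢ : ∀ a → succ (succ (succ (succ a))) ≢ a
  succ⁴≢ a = short-orbit-free 4 a (s≤s (s≤s (s≤s (s≤s z≤n))))

  pred≢succ : ∀ a → pred a ≢ succ a
  pred≢succ a e = succ²≢ a (sym (pred⇒succ (sym e)))

  Adjacent-sym : ∀ {a b} → Adjacent a b → Adjacent b a
  Adjacent-sym = [ inj₂ , inj₁ ]

  Adjacent-succ : ∀ a → Adjacent a (succ a)
  Adjacent-succ a = inj₁ refl

  Adjacent-pred : ∀ a → Adjacent a (pred a)
  Adjacent-pred a = inj₂ (sym (succ-pred a))

  ¬Adjacent-succ² : ∀ a → ¬ Adjacent a (succ (succ a))
  ¬Adjacent-succ² a (inj₁ e) = succ≢ (succ a) e
  ¬Adjacent-succ² a (inj₂ e) = succ³≢ a (sym e)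

  ¬Adjacent-succ³ : ∀ a → ¬ Adjacent a (succ (succ (succ a)))
  ¬Adjacent-succ³ a (inj₁ e) = succ²≢ a (succ-injective e)
  ¬Adjacent-succ³ a (inj₂ e) = succ⁴≢ a (sym e)

  ¬Adjacent-pred-succ : ∀ a → ¬ Adjacent (pred a) (succ a)
  ¬Adjacent-pred-succ a = subst (¬_ ∘ Adjacent (pred a)) (cong succ (succ-pred a)) (¬Adjacent-succ² (pred a))

  edge-has-no-common-neighbour : ∀ {k p} → k ≢ p → k ≢ succ p → Adjacent k p → ¬ Adjacent k (succ p)
  edge-has-no-common-neighbour k≢p _ _ (inj₁ e) = k≢p (sym (succ-injective e))
  edge-has-no-common-neighbour _ k≢sp (inj₂ e) _ = k≢sp e
  edge-has-no-common-neighbour _ _ (inj₁ e) (inj₂ e′) = succ³≢ _ (sym (trans e (cong succ e′)))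

  OffEdge-succ² : ∀ a → OffEdge a (succ (succ a))
  OffEdge-succ² a = succ²≢ a , succ≢ (succ a)

  OffEdge-succ³ : ∀ a → OffEdge a (succ (succ (succ a)))
  OffEdge-succ³ a = succ³≢ a , succ²≢ (succ a)

  OffEdge-succ⁴ : ∀ a → OffEdge a (succ (succ (succ (succ a))))
  OffEdge-succ⁴ a = succ⁴≢ a , succ³≢ (succ a)

  fold-succ-fold-pred : ∀ k a → fold (fold a pred k) succ k ≡ a
  fold-succ-fold-pred zero a = refl
  fold-succ-fold-pred (suc k) a = begin
    succ (fold (pred b) succ k) ≡⟨ fold-succ succ (pred b) k ⟨
    fold (succ (pred b)) succ k ≡⟨ cong (λ x → fold x succ k) (succ-pred b) ⟩
    fold b succ k               ≡⟨ fold-succ-fold-pred k a ⟩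
    a                           ∎
    where
    open ≡-Reasoning
    b = fold a pred k

  reverse : Rotation A
  reverse = record
    { succ = pred
    ; pred = succ
    ; succ-pred = pred-succ
    ; pred-succ = succ-pred
    ; short-orbit-free = λ k a k≤4 e →
        short-orbit-free k a k≤4 (trans (cong (λ x → fold x succ k) (sym e)) (fold-succ-fold-pred k a))
    }

  Adjacent-reverse : ∀ a b → Rotation.Adjacent reverse a b ⟺ Adjacent a b
  Adjacent-reverse a b = [ inj₂ ∘ pred⇒succ , inj₁ ∘ pred⇒succ ]
                       , [ inj₂ ∘ succ⇒pred , inj₁ ∘ succ⇒pred ]

module _ {m : ℕ} where

  [1+m%n]%n≡[1+m]%n : ∀ x → suc (x % suc m) % suc m ≡ suc x % suc m
  [1+m%n]%n≡[1+m]%n x = begin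
    (1 + x % n) % n             ≡⟨ %-distribˡ-+ 1 (x % n) n ⟩
    (1 % n + x % n % n) % n     ≡⟨ cong (λ t → (1 % n + t) % n) (m%n%n≡m%n x n) ⟩
    (1 % n + x % n) % n         ≡⟨ %-distribˡ-+ 1 x n ⟨
    (1 + x) % n                 ∎
    where
    open ≡-Reasoning
    n = suc m

  toℕ-fold-next : ∀ (a : Fin (suc m)) k → toℕ (fold a next k) ≡ (toℕ a + k) % suc m
  toℕ-fold-next a zero = trans (sym (m<n⇒m%n≡m (toℕ<n a))) (cong (_% suc m) (sym (+-identityʳ (toℕ a))))
  toℕ-fold-next a (suc k) = begin
    toℕ (next (fold a next k))       ≡⟨ toℕ-fromℕ< (m%n<n (suc (toℕ (fold a next k))) (suc m)) ⟩
    suc (toℕ (fold a next k)) % suc m ≡⟨ cong (λ t → suc t % suc m) (toℕ-fold-next a k) ⟩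
    suc ((toℕ a + k) % suc m) % suc m ≡⟨ [1+m%n]%n≡[1+m]%n (toℕ a + k) ⟩
    suc (toℕ a + k) % suc m           ≡⟨ cong (_% suc m) (+-suc (toℕ a) k) ⟨
    (toℕ a + suc k) % suc m           ∎
    where open ≡-Reasoning

  fold-next-fixed⇒∣ : ∀ (a : Fin (suc m)) k → fold a next k ≡ a → suc m ∣ k
  fold-next-fixed⇒∣ a k e = divides ((t + k) / suc m) (+-cancelˡ-≡ t k _ (begin
    t + k                             ≡⟨ m≡m%n+[m/n]*n (t + k) (suc m) ⟩
    (t + k) % suc m + (t + k) / suc m * suc m ≡⟨ cong (_+ (t + k) / suc m * suc m) fixed ⟩
    t + (t + k) / suc m * suc m       ∎))
    where
    open ≡-Reasoning
    t = toℕ a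
    fixed : (t + k) % suc m ≡ t
    fixed = trans (sym (toℕ-fold-next a k)) (cong toℕ e)

  ∣⇒fold-next-fixed : ∀ (a : Fin (suc m)) k → suc m ∣ k → fold a next k ≡ a
  ∣⇒fold-next-fixed a k d = toℕ-injective (begin
    toℕ (fold a next k)  ≡⟨ toℕ-fold-next a k ⟩
    (toℕ a + k) % suc m  ≡⟨ %-remove-+ʳ (toℕ a) d ⟩
    toℕ a % suc m        ≡⟨ m<n⇒m%n≡m (toℕ<n a) ⟩
    toℕ a                ∎)
    where open ≡-Reasoning

finRotation : ∀ m → 4 ≤ m → Rotation (Fin (suc m))
finRotation m 4≤m = record
  { succ = next
  ; pred = λ a → fold a next m
  ; succ-pred = λ a → ∣⇒fold-next-fixed a (suc m) ∣-refl
  ; pred-succ = λ a → trans (fold-succ next a m) (∣⇒fold-next-fixed a (suc m) ∣-refl)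
  ; short-orbit-free = λ k a k≤4 e → >⇒∤ (s≤s (≤-trans k≤4 4≤m)) (fold-next-fixed⇒∣ a k e)
  }

module EdgeNeighbourhood {n : ℕ} (R : Rotation (Fin n)) (S : Fin n → Set) (S? : Decidable S)
  {i : Fin n} (S-i : S i) (S-succ-i : S (Rotation.succ R i)) where
  open Rotation R
  open RotationProperties R

  Outside : Fin n → Set
  Outside k = OffEdge i k × S k

  on-or-off : ∀ k → k ≡ i ⊎ k ≡ succ i ⊎ OffEdge i k
  on-or-off k with k ≟ i | k ≟ succ i
  ... | yes e | _ = inj₁ e
  ... | no _ | yes e = inj₂ (inj₁ e)
  ... | no k≢i | no k≢si = inj₂ (inj₂ (k≢i , k≢si))

  Outside? : Decidable Outside
  Outside? k = (¬? (k ≟ i) ×-dec ¬? (k ≟ succ i)) ×-dec S? k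

  on-edge⇒S : ∀ {k} → k ≡ i ⊎ k ≡ succ i → S k
  on-edge⇒S (inj₁ refl) = S-i
  on-edge⇒S (inj₂ refl) = S-succ-i

  S⇔edge : (∀ k → ¬ Outside k) → ∀ k → S k ⟺ (k ≡ i ⊎ k ≡ succ i)
  S⇔edge none k = to , on-edge⇒S
    where
    to : S k → k ≡ i ⊎ k ≡ succ i
    to s with on-or-off k
    ... | inj₁ e = inj₁ e
    ... | inj₂ (inj₁ e) = inj₂ e
    ... | inj₂ (inj₂ off) = ⊥-elim (none k (off , s))

  S⇔two-edges : ∀ j → (∀ k → Outside k → k ≡ j ⊎ k ≡ succ j) → S j → S (succ j) →
    ∀ k → S k ⟺ (k ≡ i ⊎ k ≡ succ i ⊎ k ≡ j ⊎ k ≡ succ j)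
  S⇔two-edges j covers S-j S-succ-j k = to , from
    where
    to : S k → k ≡ i ⊎ k ≡ succ i ⊎ k ≡ j ⊎ k ≡ succ j
    to s with on-or-off k
    ... | inj₁ e = inj₁ e
    ... | inj₂ (inj₁ e) = inj₂ (inj₁ e)
    ... | inj₂ (inj₂ off) = inj₂ (inj₂ (covers k (off , s)))
    from : k ≡ i ⊎ k ≡ succ i ⊎ k ≡ j ⊎ k ≡ succ j → S k
    from (inj₁ refl) = S-i
    from (inj₂ (inj₁ refl)) = S-succ-i
    from (inj₂ (inj₂ (inj₁ refl))) = S-j
    from (inj₂ (inj₂ (inj₂ refl))) = S-succ-j

  TwoEdges : Set
  TwoEdges = ∃ λ j → j ≢ i × (∀ k → S k ⟺ (k ≡ i ⊎ k ≡ succ i ⊎ k ≡ j ⊎ k ≡ succ j))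

  module _ (outside-adjacent : ∀ a b → Outside a → Outside b → a ≢ b → Adjacent a b)
    (outside-supported : ∀ a → Outside a → OffEdge i (pred a) → OffEdge i (succ a) →
      S (pred a) ⊎ S (succ a)) where

    outside-edge : ∀ p → Outside p → Outside (succ p) → TwoEdges
    outside-edge p out-p out-sp = p , proj₁ (proj₁ out-p) , S⇔two-edges p covers (proj₂ out-p) (proj₂ out-sp)
      where
      covers : ∀ k → Outside k → k ≡ p ⊎ k ≡ succ p
      covers k out-k with k ≟ p | k ≟ succ p
      ... | yes e | _ = inj₁ e
      ... | no _ | yes e = inj₂ e
      ... | no k≢p | no k≢sp = ⊥-elim (edge-has-no-common-neighbour k≢p k≢sp
              (outside-adjacent k p out-k out-p k≢p) (outside-adjacent k (succ p) out-k out-sp k≢sp))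

    only-outside : ∀ a → Outside a → ¬ Outside (pred a) → ¬ Outside (succ a) → ∀ k → Outside k → k ≡ a
    only-outside a out-a ¬out-pa ¬out-sa k out-k with k ≟ a
    ... | yes e = e
    ... | no k≢a with outside-adjacent k a out-k out-a k≢a
    ...   | inj₁ a≡sk = ⊥-elim (¬out-pa (subst Outside (succ⇒pred a≡sk) out-k))
    ...   | inj₂ k≡sa = ⊥-elim (¬out-sa (subst Outside k≡sa out-k))

    lone-outside : ∀ a → Outside a → ¬ Outside (pred a) → ¬ Outside (succ a) →
      (∀ k → Outside k → k ≡ a) → TwoEdges
    lone-outside a out-a ¬out-pa ¬out-sa only with on-or-off (pred a) | on-or-off (succ a)
    ... | inj₁ pa≡i | _ = ⊥-elim (proj₂ (proj₁ out-a) (pred⇒succ (sym pa≡i)))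
    ... | inj₂ (inj₁ pa≡si) | _ =
      succ i , succ≢ i , S⇔two-edges (succ i) (λ k out-k → inj₂ (trans (only k out-k) a≡s²i))
                            S-succ-i (subst S a≡s²i (proj₂ out-a))
      where
      a≡s²i : a ≡ succ (succ i)
      a≡s²i = pred⇒succ (sym pa≡si)
    ... | inj₂ (inj₂ _) | inj₁ sa≡i =
      a , proj₁ (proj₁ out-a) , S⇔two-edges a (λ k out-k → inj₁ (only k out-k))
                                  (proj₂ out-a) (subst S (sym sa≡i) S-i)
    ... | inj₂ (inj₂ _) | inj₂ (inj₁ sa≡si) = ⊥-elim (proj₁ (proj₁ out-a) (succ-injective sa≡si))
    ... | inj₂ (inj₂ off-pa) | inj₂ (inj₂ off-sa) =
      ⊥-elim ([ ¬out-pa ∘ (off-pa ,_) , ¬out-sa ∘ (off-sa ,_) ] (outside-supported a out-a off-pa off-sa))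

    around : ∀ a → Outside a → TwoEdges
    around a out-a with Outside? (pred a) | Outside? (succ a)
    ... | yes out-pa | _ = outside-edge (pred a) out-pa (subst Outside (sym (succ-pred a)) out-a)
    ... | no _ | yes out-sa = outside-edge a out-a out-sa
    ... | no ¬out-pa | no ¬out-sa =
      lone-outside a out-a ¬out-pa ¬out-sa (only-outside a out-a ¬out-pa ¬out-sa)

    edge-neighbourhood : (∀ k → S k ⟺ (k ≡ i ⊎ k ≡ succ i)) ⊎ TwoEdges
    edge-neighbourhood with any? Outside?
    ... | no none = inj₁ (S⇔edge (λ k out-k → none (k , out-k)))
    ... | yes (a , out-a) = inj₂ (around a out-a)

module _ (G : Graph) where
  open Graph G

  neighbours-off-path-adjacent : ForkFree G → ∀ {z u w x y} → z ~ u → u ~ w → ¬ z ~ w →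
    z ~ x → z ~ y → ¬ u ~ x → ¬ u ~ y → ¬ w ~ x → ¬ w ~ y → x ≢ y → x ~ y
  neighbours-off-path-adjacent fork-free {z} {u} {w} {x} {y} z~u u~w z≁w z~x z~y u≁x u≁y w≁x w≁y x≢y
    with ~-dec x y
  ... | yes x~y = x~y
  ... | no x≁y = ⊥-elim (fork-free z x y u w record
    { ab = z~x ; ac = z~y ; ad = z~u ; de = u~w ; nbc = x≁y ; nbd = u≁x ∘ ~-sym ; nbe = w≁x ∘ ~-sym
    ; ncd = u≁y ∘ ~-sym ; nce = w≁y ∘ ~-sym ; nae = z≁w ; b≢c = x≢y })

  record InducedCycle (A : Set) : Set where
    field
      rotation : Rotation A
      vertex : A → V G
      vertex-injective : ∀ a b → vertex a ≡ vertex b → a ≡ b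
      vertex-adjacent⇔ : ∀ a b → vertex a ~ vertex b ⟺ Rotation.Adjacent rotation a b

    open Rotation rotation public
    open RotationProperties rotation public

    vertex-adjacent : ∀ {a b} → Adjacent a b → vertex a ~ vertex b
    vertex-adjacent {a} {b} = proj₂ (vertex-adjacent⇔ a b)

    vertex-nonadjacent : ∀ {a b} → ¬ Adjacent a b → ¬ vertex a ~ vertex b
    vertex-nonadjacent {a} {b} ¬adj = ¬adj ∘ proj₁ (vertex-adjacent⇔ a b)

  reverse-cycle : ∀ {A} → InducedCycle A → InducedCycle A
  reverse-cycle H = record
    { rotation = reverse
    ; vertex = vertex
    ; vertex-injective = vertex-injective
    ; vertex-adjacent⇔ = λ a b → proj₂ (Adjacent-reverse a b) ∘ proj₁ (vertex-adjacent⇔ a b)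
                               , proj₂ (vertex-adjacent⇔ a b) ∘ proj₁ (Adjacent-reverse a b)
    }
    where open InducedCycle H

  -- u ∈ Uᵢ, its neighbour w ∈ M(C), and its neighbour z ∈ Z.
  record Attachment {A} (H : InducedCycle A) (i : A) (u z w : V G) : Set where
    open InducedCycle H
    field
      z~u : z ~ u
      u~w : u ~ w
      z≁w : ¬ z ~ w
      z≢w : z ≢ w
      z∉C : ∀ k → z ≢ vertex k
      w≁C : ∀ k → ¬ w ~ vertex k
      u~i : u ~ vertex i
      u~succ-i : u ~ vertex (succ i)
      u≁off-edge : ∀ k → OffEdge i k → ¬ u ~ vertex k

  reverse-attachment : ∀ {A} {H : InducedCycle A} {i u z w} → Attachment H i u z w →
    Attachment (reverse-cycle H) (InducedCycle.succ H i) u z w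
  reverse-attachment {H = H} {i} att = record
    { z~u = z~u ; u~w = u~w ; z≁w = z≁w ; z≢w = z≢w ; z∉C = z∉C ; w≁C = w≁C
    ; u~i = u~succ-i
    ; u~succ-i = subst (λ k → _ ~ vertex k) (sym (pred-succ i)) u~i
    ; u≁off-edge = λ k (k≢si , k≢psi) →
        u≁off-edge k ((λ e → k≢psi (trans e (sym (pred-succ i)))) , k≢si)
    }
    where
    open InducedCycle H
    open Attachment att

  module _ (fork-free : ForkFree G) {A : Set} {H : InducedCycle A} {i : A} {u z w : V G}
    (att : Attachment H i u z w) where
    open InducedCycle H
    open Attachment att

    private
      v = vertex
      i₁ = succ i
      i₂ = succ i₁
      i₃ = succ i₂
      i₄ = succ i₃

    w∉C : ∀ k → w ≢ v k
    w∉C k e = w≁C (succ k) (subst (_~ v (succ k)) (sym e) (vertex-adjacent (Adjacent-succ k)))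

    off-edge-neighbours-adjacent : ∀ a b → OffEdge i a → OffEdge i b →
      z ~ v a → z ~ v b → a ≢ b → Adjacent a b
    off-edge-neighbours-adjacent a b off-a off-b z~a z~b a≢b = proj₁ (vertex-adjacent⇔ a b)
      (neighbours-off-path-adjacent fork-free z~u u~w z≁w z~a z~b
        (u≁off-edge a off-a) (u≁off-edge b off-b) (w≁C a) (w≁C b) (a≢b ∘ vertex-injective a b))

    z≁i₁⇒z~i₂ : ¬ z ~ v i₁ → z ~ v i₂
    z≁i₁⇒z~i₂ z≁i₁ with ~-dec z (v i₂)
    ... | yes z~i₂ = z~i₂
    ... | no z≁i₂ = ⊥-elim (fork-free u z w (v i₁) (v i₂) record
      { ab = ~-sym z~u ; ac = u~w ; ad = u~succ-i ; de = vertex-adjacent (Adjacent-succ i₁)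
      ; nbc = z≁w ; nbd = z≁i₁ ; nbe = z≁i₂ ; ncd = w≁C i₁ ; nce = w≁C i₂
      ; nae = u≁off-edge i₂ (OffEdge-succ² i) ; b≢c = z≢w })

    z≁i₁⇒z≁i₃ : ¬ z ~ v i₁ → ¬ z ~ v i₃
    z≁i₁⇒z≁i₃ z≁i₁ z~i₃ = fork-free u (v i₁) w z (v i₃) record
      { ab = u~succ-i ; ac = u~w ; ad = ~-sym z~u ; de = z~i₃
      ; nbc = w≁C i₁ ∘ ~-sym ; nbd = z≁i₁ ∘ ~-sym ; nbe = vertex-nonadjacent (¬Adjacent-succ² i₁)
      ; ncd = z≁w ∘ ~-sym ; nce = w≁C i₃ ; nae = u≁off-edge i₃ (OffEdge-succ³ i)
      ; b≢c = w∉C i₁ ∘ sym }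

    z≁i₁⇒z~i₃ : ¬ z ~ v i₁ → z ~ v i₃
    z≁i₁⇒z~i₃ z≁i₁ with ~-dec z (v i₃)
    ... | yes z~i₃ = z~i₃
    ... | no z≁i₃ = ⊥-elim (fork-free (v i₂) (v i₁) z (v i₃) (v i₄) record
      { ab = vertex-adjacent (Adjacent-sym (Adjacent-succ i₁)) ; ac = ~-sym z~i₂
      ; ad = vertex-adjacent (Adjacent-succ i₂) ; de = vertex-adjacent (Adjacent-succ i₃)
      ; nbc = z≁i₁ ∘ ~-sym ; nbd = vertex-nonadjacent (¬Adjacent-succ² i₁)
      ; nbe = vertex-nonadjacent (¬Adjacent-succ³ i₁) ; ncd = z≁i₃ ; nce = z≁i₄
      ; nae = vertex-nonadjacent (¬Adjacent-succ² i₂) ; b≢c = λ e → z∉C i₁ (sym e) })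
      where
      z~i₂ = z≁i₁⇒z~i₂ z≁i₁
      z≁i₄ : ¬ z ~ v i₄
      z≁i₄ z~i₄ = ¬Adjacent-succ² i₂ (off-edge-neighbours-adjacent i₂ i₄
        (OffEdge-succ² i) (OffEdge-succ⁴ i) z~i₂ z~i₄ (succ²≢ i₂ ∘ sym))

    z~succ-i : z ~ v (succ i)
    z~succ-i with ~-dec z (v i₁)
    ... | yes z~i₁ = z~i₁
    ... | no z≁i₁ = ⊥-elim (z≁i₁⇒z≁i₃ z≁i₁ (z≁i₁⇒z~i₃ z≁i₁))

    off-edge-neighbour-supported : ∀ a → OffEdge i a → z ~ v a →
      OffEdge i (pred a) → OffEdge i (succ a) → z ~ v (pred a) ⊎ z ~ v (succ a)
    off-edge-neighbour-supported a off-a z~a off-pa off-sa with ~-dec z (v (pred a)) | ~-dec z (v (succ a))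
    ... | yes z~pa | _ = inj₁ z~pa
    ... | no _ | yes z~sa = inj₂ z~sa
    ... | no z≁pa | no z≁sa = ⊥-elim (fork-free (v a) (v (pred a)) (v (succ a)) z u record
      { ab = vertex-adjacent (Adjacent-pred a) ; ac = vertex-adjacent (Adjacent-succ a)
      ; ad = ~-sym z~a ; de = z~u
      ; nbc = vertex-nonadjacent (¬Adjacent-pred-succ a) ; nbd = z≁pa ∘ ~-sym
      ; nbe = u≁off-edge (pred a) off-pa ∘ ~-sym ; ncd = z≁sa ∘ ~-sym
      ; nce = u≁off-edge (succ a) off-sa ∘ ~-sym ; nae = u≁off-edge a off-a ∘ ~-sym
      ; b≢c = pred≢succ a ∘ vertex-injective (pred a) (succ a) })

  z~i : ForkFree G → ∀ {A} {H : InducedCycle A} {i u z w} → Attachment H i u z w → z ~ InducedCycle.vertex H i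
  z~i fork-free {H = H} {i} att =
    subst (λ k → _ ~ vertex k) (pred-succ i) (z~succ-i fork-free (reverse-attachment att))
    where open InducedCycle H

  module _ (fork-free : ForkFree G) {n : ℕ} {H : InducedCycle (Fin n)} {i : Fin n} {u z w : V G}
    (att : Attachment H i u z w) where
    open InducedCycle H
    open EdgeNeighbourhood rotation (λ k → z ~ vertex k) (λ k → ~-dec z (vertex k))
      (z~i fork-free att) (z~succ-i fork-free att)

    attached-neighbourhood : (∀ k → z ~ vertex k ⟺ (k ≡ i ⊎ k ≡ succ i)) ⊎ TwoEdges
    attached-neighbourhood = edge-neighbourhood
      (λ a b (off-a , z~a) (off-b , z~b) → off-edge-neighbours-adjacent fork-free att a b off-a off-b z~a z~b)
      (λ a (off-a , z~a) → off-edge-neighbour-supported fork-free att a off-a z~a)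

-- No trailing ⊥, so that OneOf unfolds to exactly the disjunctions of the statement.
OneOf : {A : Set} → A → List A → A → Set
OneOf x [] y = y ≡ x
OneOf x (x′ ∷ xs) y = y ≡ x ⊎ OneOf x′ xs y

OneOf-map : ∀ {A B : Set} (f : A → B) {x xs k} → OneOf x xs k → OneOf (f x) (map f xs) (f k)
OneOf-map f {xs = []} e = cong f e
OneOf-map f {xs = _ ∷ _} (inj₁ e) = inj₁ (cong f e)
OneOf-map f {xs = _ ∷ _} (inj₂ o) = inj₂ (OneOf-map f o)

OneOf-map⁻ : ∀ {A B : Set} (f : A → B) {x xs y} → OneOf (f x) (map f xs) y → ∃ λ k → f k ≡ y × OneOf x xs k
OneOf-map⁻ f {x} {[]} e = x , sym e , refl
OneOf-map⁻ f {x} {_ ∷ _} (inj₁ e) = x , sym e , inj₁ refl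
OneOf-map⁻ f {x} {_ ∷ _} (inj₂ o) = map₂ (map₂ inj₂) (OneOf-map⁻ f o)

4≤2k+1⇒4≤2k : ∀ k → 4 ≤ suc (2 * k) → 4 ≤ 2 * k
4≤2k+1⇒4≤2k 0 (s≤s ())
4≤2k+1⇒4≤2k 1 (s≤s (s≤s (s≤s ())))
4≤2k+1⇒4≤2k (suc (suc k)) _ = *-monoʳ-≤ 2 (s≤s (s≤s (z≤n {k})))

module _ (G : Graph) where
  open Graph G

  InNC⇔OneOf : ∀ {n} (c : Fin n → V G) {z} x xs → (∀ k → z ~ c k ⟺ OneOf x xs k) →
    ∀ y → InNC G c z y ⟺ OneOf (c x) (map c xs) y
  InNC⇔OneOf c {z} x xs z~⇔ y = to , from
    where
    to : InNC G c z y → OneOf (c x) (map c xs) y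
    to ((k , refl) , z~y) = OneOf-map c (proj₁ (z~⇔ k) z~y)
    from : OneOf (c x) (map c xs) y → InNC G c z y
    from o with OneOf-map⁻ c o
    ... | k , refl , o′ = (k , refl) , proj₂ (z~⇔ k) o′

  oddHoleCycle : ∀ {m} {c : Fin (suc m) → V G} → 4 ≤ m → OddHole G (suc m) c → InducedCycle G (Fin (suc m))
  oddHoleCycle {m} {c} 4≤m hole = record
    { rotation = finRotation m 4≤m
    ; vertex = c
    ; vertex-injective = OddHole.inj hole
    ; vertex-adjacent⇔ = OddHole.induced hole
    }

  attachment : ∀ {m} {c : Fin (suc m) → V G} (4≤m : 4 ≤ m) (hole : OddHole G (suc m) c) {i z} →
    InZ G c z → InN G (InUi G c i) z → ∃ λ u → ∃ λ w → Attachment G (oddHoleCycle 4≤m hole) i u z w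
  attachment {c = c} _ hole {i}
    (z∈N[C]@(z∉C , _ , (k₀ , refl) , k₀~z) , z∉N[M[C]] , _)
    (_ , u , (((_ , w , w∈M[C]@(w∉C , w∉N[C]) , w~u) , _) , N[u]≡edge) , u~z) = u , w , record
    { z~u = ~-sym u~z
    ; u~w = ~-sym w~u
    ; z≁w = λ z~w → z∉N[M[C]] ((λ z∈M[C] → proj₂ z∈M[C] z∈N[C]) , w , w∈M[C] , ~-sym z~w)
    ; z≢w = λ { refl → w≁C k₀ (~-sym k₀~z) }
    ; z∉C = λ k e → z∉C (k , sym e)
    ; w≁C = w≁C
    ; u~i = proj₂ (proj₂ (N[u]≡edge (c i)) (inj₁ refl))
    ; u~succ-i = proj₂ (proj₂ (N[u]≡edge (c (next i))) (inj₂ refl))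
    ; u≁off-edge = λ k (k≢i , k≢si) u~k →
        [ k≢i ∘ OddHole.inj hole k i , k≢si ∘ OddHole.inj hole k (next i) ]
          (proj₁ (N[u]≡edge (c k)) ((k , refl) , u~k))
    }
    where
    w≁C : ∀ k → ¬ w ~ c k
    w≁C k w~k = w∉N[C] (w∉C , c k , (k , refl) , ~-sym w~k)

lemma2p14 : (G : Graph) → ForkFree G → MinimalNonPerfectlyDivisible G →
    (v : V G) → (n : ℕ) → (c : Fin n → V G) → OddHole G n c →
    (∀ k → InM G v (c k)) →
    (i : Fin n) → (z : V G) → InZ G c z → InN G (InUi G c i) z →
    NCpair G c z i
    ⊎ ∃ (λ j → j ≢ i × (∀ y → InNC G c z y ⟺
        (y ≡ c i ⊎ y ≡ c (next i) ⊎ y ≡ c j ⊎ y ≡ c (next j))))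
lemma2p14 G fork-free _ _ n c hole _ i z z∈Z z∈N[Uᵢ] with OddHole.odd hole
... | k , refl with attachment G (4≤2k+1⇒4≤2k k (OddHole.length≥4 hole)) hole z∈Z z∈N[Uᵢ]
...   | u , w , att =
  [ (λ z~⇔ → inj₁ (InNC⇔OneOf G c i (next i ∷ []) z~⇔))
  , (λ (j , j≢i , z~⇔) → inj₂ (j , j≢i , InNC⇔OneOf G c i (next i ∷ j ∷ next j ∷ []) z~⇔))
  ] (attached-neighbourhood G fork-free att)
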